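{- Let $G$ be a simple graph, let $e=v_iv_j$ be an edge of $G$, and let $v$ be the vertex of the line graph $L(G)$ corresponding to $e$. Then $$d^p_{L(G)}(v)=\Lambda+\binom{d(v_i)-1}{2}+\binom{d(v_j)-1}{2},$$ where $\Lambda$ is the number of triangles of $G$ containing the edge $e$ and $d(\cdot)$ denotes degree in $G$.
   Context: The line graph $L(G)$ has the edges of $G$ as vertices, two of them adjacent if and only if they share an endpoint in $G$. The primitive degree $d^p_H(v)$ of a vertex $v$ of a graph $H$ is the number of triangles ($C_3$ subgraphs) of $H$ containing $v$. -}

module Defs where

open import Data.Nat using (ℕ; _<ᵇ_)
open import Data.Bool using (Bool; true; false; _∧_; _∨_; not; T)
open import Data.Fin using (Fin; toℕ; _≟_)
open import Data.List using (List; []; _∷_; length; filter; allFin; concatMap; map; cartesianProduct; lookup)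
open import Data.Product using (_×_; _,_; proj₁; proj₂)
open import Relation.Binary.PropositionalEquality using (_≡_; refl; cong; cong₂) renaming (sym to ≡-sym)
open import Relation.Nullary using (yes; no)
open import Data.Empty using (⊥-elim)
open import Relation.Nullary.Decidable using (⌊_⌋; T?)

record Graph : Set where
  field
    n     : ℕ
    adj   : Fin n → Fin n → Bool
    sym   : ∀ x y → adj x y ≡ adj y x
    irrefl : ∀ x → adj x x ≡ false
open Graph public

count : {A : Set} → (A → Bool) → List A → ℕ
count p xs = length (filter (λ x → T? (p x)) xs)

deg : (G : Graph) → Fin (n G) → ℕ
deg G x = count (adj G x) (allFin (n G))

triples : (m : ℕ) → List (Fin m × Fin m × Fin m)
triples m = cartesianProduct (allFin m) (cartesianProduct (allFin m) (allFin m))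

-- triangles of G: 3-element vertex sets {a,b,c} (listed with a < b < c)
-- whose vertices are pairwise adjacent
isTriangle : (G : Graph) → Fin (n G) × Fin (n G) × Fin (n G) → Bool
isTriangle G (a , b , c) =
  (toℕ a <ᵇ toℕ b) ∧ (toℕ b <ᵇ toℕ c) ∧ adj G a b ∧ adj G b c ∧ adj G a c

contains : {m : ℕ} → Fin m × Fin m × Fin m → Fin m → Bool
contains (a , b , c) x = ⌊ x ≟ a ⌋ ∨ ⌊ x ≟ b ⌋ ∨ ⌊ x ≟ c ⌋

primDeg : (G : Graph) → Fin (n G) → ℕ
primDeg G x = count (λ t → isTriangle G t ∧ contains t x) (triples (n G))

triEdge : (G : Graph) → Fin (n G) → Fin (n G) → ℕ
triEdge G x y =
  count (λ t → isTriangle G t ∧ contains t x ∧ contains t y) (triples (n G))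

edges : (G : Graph) → List (Fin (n G) × Fin (n G))
edges G = filter (λ e → T? ((toℕ (proj₁ e) <ᵇ toℕ (proj₂ e)) ∧ adj G (proj₁ e) (proj₂ e)))
                 (cartesianProduct (allFin (n G)) (allFin (n G)))

_==_ : {m : ℕ} → Fin m → Fin m → Bool
x == y = ⌊ x ≟ y ⌋

==-sym : {m : ℕ} (x y : Fin m) → (x == y) ≡ (y == x)
==-sym x y with x ≟ y | y ≟ x
... | yes _ | yes _ = refl
... | no _  | no _  = refl
... | yes p | no q  = ⊥-elim (q (≡-sym p))
... | no p  | yes q = ⊥-elim (p (≡-sym q))

==-refl : {m : ℕ} (x : Fin m) → (x == x) ≡ true
==-refl x with x ≟ x
... | yes _ = refl
... | no q  = ⊥-elim (q refl)

share : {m : ℕ} → Fin m × Fin m → Fin m × Fin m → Bool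
share (a , b) (c , d) = (a == c) ∨ (a == d) ∨ (b == c) ∨ (b == d)

share-sym : {m : ℕ} (e f : Fin m × Fin m) → share e f ≡ share f e
share-sym (a , b) (c , d)
  rewrite ==-sym a c | ==-sym a d | ==-sym b c | ==-sym b d
  = lemma (c == a) (d == a) (c == b) (d == b)
  where
  lemma : ∀ p q r s → (p ∨ q ∨ r ∨ s) ≡ (p ∨ r ∨ q ∨ s)
  lemma true  q r s = refl
  lemma false true  true  s = refl
  lemma false true  false s = refl
  lemma false false r s = refl

-- The line graph L(G): its vertices are the edges of G (indexed by
-- positions in  edges G ), two distinct ones adjacent iff they share an
-- endpoint in G.
lineGraph : Graph → Graph
lineGraph G = record
  { n = length (edges G)
  ; adj = λ k l → not (k == l) ∧ share (lookup (edges G) k) (lookup (edges G) l)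
  ; sym = λ k l → cong₂ (λ u w → not u ∧ w) (==-sym k l)
                    (share-sym (lookup (edges G) k) (lookup (edges G) l))
  ; irrefl = λ k → cong (λ u → not u ∧ share (lookup (edges G) k) (lookup (edges G) k)) (==-refl k)
  }

module Submission where

-- The proof double-counts, with indicator sums over Fin:
--  * in any graph, twice the number of triangles through a vertex v is the
--    number of ordered pairs (x , y) with v, x, y pairwise adjacent
--    (TrianglesThrough); for the edge e this gives  2Λ = 2 · common(i , j);
--  * L(G) is the loopless part of the reflexive relation "shares an endpoint";
--    inclusion–exclusion over coincidences (Loopless) turns the ordered pairs
--    in L(G) into  2 d^p(v) + 3N = Q + 2 , where N counts the edges meeting e
--    and Q the ordered pairs of edges meeting e and each other;
--  * splitting the edges meeting e into those at i and those at j (EdgeSums)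
--    gives  N + 1 = d(i) + d(j)  and expresses Q through degrees and common
--    neighbours of i and j;
--  * a closing computation in ℕ eliminates N and Q.

open import Defs
open import Data.Nat using (ℕ; zero; suc; _+_; _*_; _∸_; _<ᵇ_; _<_)
open import Data.Nat.Properties
  using ( +-identityʳ; *-identityˡ; *-identityʳ; *-zeroʳ; +-comm; *-comm; +-assoc; *-assoc
        ; *-distribˡ-+; *-distribʳ-+; +-cancelʳ-≡; *-cancelˡ-≡; m+n∸n≡m
        ; <-cmp; <-trans; <-irrefl; <-asym; <⇒<ᵇ; <ᵇ⇒<; +-*-semiring)
open import Data.Nat.Combinatorics using (_C_; nC1≡n; nCk+nC[k+1]≡[n+1]C[k+1])
open import Data.Nat.Tactic.RingSolver using (solve-∀)
open import Algebra.Properties.Semiring.Sum +-*-semiring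
  using (sum-syntax; sum-cong-≗; ∑-distrib-+; ∑-comm; *-distribˡ-sum; *-distribʳ-sum; sum-replicate-zero)
open import Data.Bool using (Bool; true; false; _∧_; _∨_; not; T)
open import Data.Bool.Properties using (∨-assoc; ∨-identityˡ; ∨-comm; ∧-comm; ∧-identityʳ; ∧-zeroʳ; T-≡; T-∧)
open import Data.Fin using (Fin; toℕ; _≟_) renaming (zero to fzero; suc to fsuc)
open import Data.Fin.Properties using (toℕ-injective)
open import Data.List using (List; []; _∷_; length; filter; allFin; map; cartesianProduct; lookup; tabulate; _++_)
open import Data.Product using (_×_; _,_; proj₁; proj₂)
open import Relation.Binary.PropositionalEquality
  using (_≡_; _≢_; refl; cong; cong₂; trans; subst; module ≡-Reasoning) renaming (sym to ≡-sym)
open import Relation.Binary.Definitions using (tri<; tri≈; tri>)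
open import Relation.Nullary using (yes; no; ¬_)
open import Relation.Nullary.Decidable using (T?)
open import Data.Empty using (⊥-elim)
open import Data.List.Membership.Propositional.Properties using (∈-lookup; ∈-filter⁻)
open import Function.Bundles using (Equivalence)
open import Function using (_∘_)

χ : Bool → ℕ
χ true  = 1
χ false = 0

χ-idem : ∀ b → χ b * χ b ≡ χ b
χ-idem true  = refl
χ-idem false = refl

χ-∧ : ∀ a b → χ (a ∧ b) ≡ χ a * χ b
χ-∧ true  b = ≡-sym (+-identityʳ (χ b))
χ-∧ false b = refl

χ-∨-∧ : ∀ x y → χ (x ∨ y) + χ (x ∧ y) ≡ χ x + χ y
χ-∨-∧ true  true  = refl
χ-∨-∧ true  false = refl
χ-∨-∧ false y     = +-identityʳ (χ y)

==-suc : ∀ {n} (a x : Fin n) → (fsuc a == fsuc x) ≡ (a == x)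
==-suc a x with a ≟ x
... | yes _ = refl
... | no _  = refl

==-false : ∀ {n} {x y : Fin n} → x ≢ y → (x == y) ≡ false
==-false {x = x} {y} x≢y with x ≟ y
... | yes x≡y = ⊥-elim (x≢y x≡y)
... | no _    = refl

∑-δ : ∀ {n} (a : Fin n) (f : Fin n → ℕ) → ∑[ x < n ] (χ (a == x) * f x) ≡ f a
∑-δ {suc n} fzero f = begin
  f fzero + 0 + ∑[ x < n ] 0  ≡⟨ cong (f fzero + 0 +_) (sum-replicate-zero n) ⟩
  f fzero + 0 + 0             ≡⟨ +-identityʳ _ ⟩
  f fzero + 0                 ≡⟨ +-identityʳ _ ⟩
  f fzero                     ∎
  where open ≡-Reasoning
∑-δ {suc n} (fsuc a) f = begin
  ∑[ x < n ] (χ (fsuc a == fsuc x) * f (fsuc x))  ≡⟨ sum-cong-≗ (λ x → cong (λ b → χ b * f (fsuc x)) (==-suc a x)) ⟩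
  ∑[ x < n ] (χ (a == x) * f (fsuc x))            ≡⟨ ∑-δ a (λ x → f (fsuc x)) ⟩
  f (fsuc a)                                      ∎
  where open ≡-Reasoning

∑-δ′ : ∀ {n} (a : Fin n) (f : Fin n → ℕ) → ∑[ x < n ] (χ (x == a) * f x) ≡ f a
∑-δ′ a f = trans (sum-cong-≗ (λ x → cong (λ b → χ b * f x) (==-sym x a))) (∑-δ a f)

∑²-distrib-+ : ∀ {m} (f g : Fin m → Fin m → ℕ) →
  ∑[ x < m ] ∑[ y < m ] (f x y + g x y) ≡ ∑[ x < m ] ∑[ y < m ] f x y + ∑[ x < m ] ∑[ y < m ] g x y
∑²-distrib-+ {m} f g = trans (sum-cong-≗ (λ x → ∑-distrib-+ (f x) (g x))) (∑-distrib-+ {m} _ _)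

∑³-distrib-+ : ∀ {m} (f g : Fin m → Fin m → Fin m → ℕ) →
  ∑[ a < m ] ∑[ b < m ] ∑[ c < m ] (f a b c + g a b c)
    ≡ ∑[ a < m ] ∑[ b < m ] ∑[ c < m ] f a b c + ∑[ a < m ] ∑[ b < m ] ∑[ c < m ] g a b c
∑³-distrib-+ {m} f g = trans (sum-cong-≗ (λ a → ∑²-distrib-+ (f a) (g a))) (∑-distrib-+ {m} _ _)

∑-*ˡ : ∀ {m} k (f : Fin m → ℕ) → ∑[ x < m ] (k * f x) ≡ k * ∑[ x < m ] f x
∑-*ˡ k f = ≡-sym (*-distribˡ-sum k f)

∑-*ʳ : ∀ {m} k (f : Fin m → ℕ) → ∑[ x < m ] (f x * k) ≡ (∑[ x < m ] f x) * k
∑-*ʳ k f = ≡-sym (*-distribʳ-sum k f)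

listSum : {A : Set} → (A → ℕ) → List A → ℕ
listSum g []       = 0
listSum g (x ∷ xs) = g x + listSum g xs

count≡listSum : {A : Set} (p : A → Bool) (xs : List A) → count p xs ≡ listSum (λ x → χ (p x)) xs
count≡listSum p []       = refl
count≡listSum p (x ∷ xs) with p x
... | true  = cong suc (count≡listSum p xs)
... | false = count≡listSum p xs

listSum-filter : {A : Set} (g : A → ℕ) (p : A → Bool) (xs : List A) →
  listSum g (filter (λ x → T? (p x)) xs) ≡ listSum (λ x → χ (p x) * g x) xs
listSum-filter g p []       = refl
listSum-filter g p (x ∷ xs) with p x
... | true  = cong₂ _+_ (≡-sym (+-identityʳ (g x))) (listSum-filter g p xs)
... | false = listSum-filter g p xs

listSum-cong : {A : Set} {g h : A → ℕ} → (∀ x → g x ≡ h x) → (xs : List A) → listSum g xs ≡ listSum h xs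
listSum-cong g≡h []       = refl
listSum-cong g≡h (x ∷ xs) = cong₂ _+_ (g≡h x) (listSum-cong g≡h xs)

listSum-++ : {A : Set} (g : A → ℕ) (xs ys : List A) → listSum g (xs ++ ys) ≡ listSum g xs + listSum g ys
listSum-++ g []       ys = refl
listSum-++ g (x ∷ xs) ys = trans (cong (g x +_) (listSum-++ g xs ys)) (≡-sym (+-assoc (g x) _ _))

listSum-map : {A B : Set} (g : B → ℕ) (f : A → B) (xs : List A) → listSum g (map f xs) ≡ listSum (λ x → g (f x)) xs
listSum-map g f []       = refl
listSum-map g f (x ∷ xs) = cong (g (f x) +_) (listSum-map g f xs)

listSum-cartesianProduct : {A B : Set} (g : A × B → ℕ) (xs : List A) (ys : List B) →
  listSum g (cartesianProduct xs ys) ≡ listSum (λ x → listSum (λ y → g (x , y)) ys) xs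
listSum-cartesianProduct g []       ys = refl
listSum-cartesianProduct g (x ∷ xs) ys =
  trans (listSum-++ g (map (x ,_) ys) _)
        (cong₂ _+_ (listSum-map g (x ,_) ys) (listSum-cartesianProduct g xs ys))

listSum-tabulate : ∀ {A : Set} {m} (g : A → ℕ) (f : Fin m → A) → listSum g (tabulate f) ≡ ∑[ k < m ] g (f k)
listSum-tabulate {m = zero}  g f = refl
listSum-tabulate {m = suc m} g f = cong (g (f fzero) +_) (listSum-tabulate g (λ k → f (fsuc k)))

listSum-allFin : ∀ {m} (g : Fin m → ℕ) → listSum g (allFin m) ≡ ∑[ x < m ] g x
listSum-allFin g = listSum-tabulate g (λ x → x)

listSum-lookup : {A : Set} (g : A → ℕ) (xs : List A) → ∑[ k < length xs ] g (lookup xs k) ≡ listSum g xs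
listSum-lookup g []       = refl
listSum-lookup g (x ∷ xs) = cong (g x +_) (listSum-lookup g xs)

listSum-allFin² : ∀ {m} (g : Fin m × Fin m → ℕ) →
  listSum g (cartesianProduct (allFin m) (allFin m)) ≡ ∑[ a < m ] ∑[ b < m ] g (a , b)
listSum-allFin² {m} g =
  trans (listSum-cartesianProduct g (allFin m) (allFin m))
        (trans (listSum-allFin {m} _) (sum-cong-≗ (λ a → listSum-allFin (λ b → g (a , b)))))

count-triples : ∀ {m} (p : Fin m × Fin m × Fin m → Bool) →
  count p (triples m) ≡ ∑[ a < m ] ∑[ b < m ] ∑[ c < m ] χ (p (a , b , c))
count-triples {m} p =
  trans (count≡listSum p (triples m))
  (trans (listSum-cartesianProduct _ (allFin m) _)
  (trans (listSum-allFin {m} _)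
         (sum-cong-≗ (λ a → listSum-allFin² (λ bc → χ (p (a , bc)))))))

count-cong : {A : Set} {p q : A → Bool} → (∀ x → p x ≡ q x) → (xs : List A) → count p xs ≡ count q xs
count-cong {p = p} {q} p≡q xs =
  trans (count≡listSum p xs) (trans (listSum-cong (λ x → cong χ (p≡q x)) xs) (≡-sym (count≡listSum q xs)))

_≺_ : ∀ {m} → Fin m → Fin m → Bool
x ≺ y = toℕ x <ᵇ toℕ y

<ᵇ-true : ∀ {p q} → p < q → (p <ᵇ q) ≡ true
<ᵇ-true p<q = Equivalence.to T-≡ (<⇒<ᵇ p<q)

<ᵇ-false : ∀ {p q} → ¬ p < q → (p <ᵇ q) ≡ false
<ᵇ-false {p} {q} p≮q with p <ᵇ q in eq
... | true  = ⊥-elim (p≮q (<ᵇ⇒< p q (Equivalence.from T-≡ eq)))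
... | false = refl

≺-distinct : ∀ {m} {x y : Fin m} → T (x ≺ y) → x ≢ y
≺-distinct {x = x} x≺y refl = <-irrefl refl (<ᵇ⇒< (toℕ x) (toℕ x) x≺y)

≺-total : ∀ {m} (x y : Fin m) → x ≢ y → χ (x ≺ y) + χ (y ≺ x) ≡ 1
≺-total x y x≢y with <-cmp (toℕ x) (toℕ y)
... | tri< x<y _ y≮x rewrite <ᵇ-true x<y | <ᵇ-false y≮x = refl
... | tri≈ _ x≡y _   = ⊥-elim (x≢y (toℕ-injective x≡y))
... | tri> x≮y _ y<x rewrite <ᵇ-false x≮y | <ᵇ-true y<x = refl

∑-unordered-pairs : ∀ {m} (f : Fin m → Fin m → ℕ) →
  (∀ x y → f x y ≡ f y x) → (∀ x → f x x ≡ 0) →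
  2 * ∑[ x < m ] ∑[ y < m ] (χ (x ≺ y) * f x y) ≡ ∑[ x < m ] ∑[ y < m ] f x y
∑-unordered-pairs {m} f f-sym f-diag = begin
  2 * S<                                                       ≡⟨ cong (S< +_) (+-identityʳ S<) ⟩
  S< + S<                                                      ≡⟨ cong (S< +_) S>≡S< ⟨
  S< + ∑[ x < m ] ∑[ y < m ] (χ (y ≺ x) * f x y)
      ≡⟨ ∑²-distrib-+ (λ x y → χ (x ≺ y) * f x y) (λ x y → χ (y ≺ x) * f x y) ⟨
  ∑[ x < m ] ∑[ y < m ] (χ (x ≺ y) * f x y + χ (y ≺ x) * f x y) ≡⟨ sum-cong-≗ (λ x → sum-cong-≗ (one-order x)) ⟩
  ∑[ x < m ] ∑[ y < m ] f x y                                    ∎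
  where
  open ≡-Reasoning
  S< : ℕ
  S< = ∑[ x < m ] ∑[ y < m ] (χ (x ≺ y) * f x y)

  S>≡S< : ∑[ x < m ] ∑[ y < m ] (χ (y ≺ x) * f x y) ≡ S<
  S>≡S< = trans (∑-comm (λ x y → χ (y ≺ x) * f x y))
                (sum-cong-≗ (λ x → sum-cong-≗ (λ y → cong (χ (x ≺ y) *_) (f-sym y x))))

  one-order : ∀ x y → χ (x ≺ y) * f x y + χ (y ≺ x) * f x y ≡ f x y
  one-order x y with x ≟ y
  ... | yes refl rewrite f-diag x = cong₂ _+_ (*-zeroʳ (χ (x ≺ x))) (*-zeroʳ (χ (x ≺ x)))
  ... | no x≢y = trans (≡-sym (*-distribʳ-+ (f x y) (χ (x ≺ y)) (χ (y ≺ x))))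
                       (trans (cong (_* f x y) (≺-total x y x≢y)) (+-identityʳ (f x y)))

insertion-positions : ∀ p q r → p ≢ q → q ≢ r → p ≢ r →
  χ ((p <ᵇ q) ∧ (q <ᵇ r)) + χ ((q <ᵇ p) ∧ (p <ᵇ r)) + χ ((q <ᵇ r) ∧ (r <ᵇ p)) ≡ χ (q <ᵇ r)
insertion-positions p q r p≢q q≢r p≢r with <-cmp p q | <-cmp q r | <-cmp p r
... | tri≈ _ p≡q _ | _ | _ = ⊥-elim (p≢q p≡q)
... | _ | tri≈ _ q≡r _ | _ = ⊥-elim (q≢r q≡r)
... | _ | _ | tri≈ _ p≡r _ = ⊥-elim (p≢r p≡r)
... | tri< p<q _ q≮p | tri< q<r _ _ | tri< _ _ r≮p
  rewrite <ᵇ-true p<q | <ᵇ-false q≮p | <ᵇ-true q<r | <ᵇ-false r≮p = refl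
... | tri< p<q _ _ | tri< q<r _ _ | tri> _ _ r<p = ⊥-elim (<-asym (<-trans p<q q<r) r<p)
... | tri< p<q _ q≮p | tri> q≮r _ _ | tri< _ _ _
  rewrite <ᵇ-true p<q | <ᵇ-false q≮p | <ᵇ-false q≮r = refl
... | tri< p<q _ q≮p | tri> q≮r _ _ | tri> _ _ _
  rewrite <ᵇ-true p<q | <ᵇ-false q≮p | <ᵇ-false q≮r = refl
... | tri> p≮q _ q<p | tri< q<r _ _ | tri< p<r _ r≮p
  rewrite <ᵇ-false p≮q | <ᵇ-true q<p | <ᵇ-true q<r | <ᵇ-true p<r | <ᵇ-false r≮p = refl
... | tri> p≮q _ q<p | tri< q<r _ _ | tri> p≮r _ r<p
  rewrite <ᵇ-false p≮q | <ᵇ-true q<p | <ᵇ-true q<r | <ᵇ-false p≮r | <ᵇ-true r<p = refl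
... | tri> _ _ q<p | tri> _ _ r<q | tri< p<r _ _ = ⊥-elim (<-asym (<-trans r<q q<p) p<r)
... | tri> p≮q _ q<p | tri> q≮r _ _ | tri> p≮r _ _
  rewrite <ᵇ-false p≮q | <ᵇ-true q<p | <ᵇ-false q≮r | <ᵇ-false p≮r = refl

adjacent-distinct : (H : Graph) {x y : Fin (n H)} → T (adj H x y) → x ≢ y
adjacent-distinct H {x} xy refl = subst T (irrefl H x) xy

triangle-distinct : (H : Graph) {a b c : Fin (n H)} → T (isTriangle H (a , b , c)) → a ≢ b × b ≢ c × a ≢ c
triangle-distinct H {a} {b} {c} t with Equivalence.to (T-∧ {a ≺ b}) t
... | a≺b , rest = ≺-distinct a≺b , ≺-distinct b≺c , a≢c
  where
  b≺c : T (b ≺ c)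
  b≺c = proj₁ (Equivalence.to T-∧ rest)
  a≢c : a ≢ c
  a≢c refl = <-asym (<ᵇ⇒< (toℕ a) (toℕ b) a≺b) (<ᵇ⇒< (toℕ b) (toℕ a) b≺c)

contains-distinct : ∀ {m} (v a b c : Fin m) → a ≢ b → b ≢ c → a ≢ c →
  χ (contains (a , b , c) v) ≡ χ (v == a) + χ (v == b) + χ (v == c)
contains-distinct v a b c a≢b b≢c a≢c with v ≟ a | v ≟ b | v ≟ c
... | yes v≡a | yes v≡b | _       = ⊥-elim (a≢b (trans (≡-sym v≡a) v≡b))
... | yes v≡a | no _    | yes v≡c = ⊥-elim (a≢c (trans (≡-sym v≡a) v≡c))
... | no _    | yes v≡b | yes v≡c = ⊥-elim (b≢c (trans (≡-sym v≡b) v≡c))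
... | yes _   | no _    | no _    = refl
... | no _    | yes _   | no _    = refl
... | no _    | no _    | yes _   = refl
... | no _    | no _    | no _    = refl

∧-rotate : ∀ a b c → (a ∧ b ∧ c) ≡ (c ∧ a ∧ b)
∧-rotate true  true  c = ≡-sym (∧-identityʳ c)
∧-rotate true  false c = ≡-sym (∧-zeroʳ c)
∧-rotate false b     c = ≡-sym (∧-zeroʳ c)

∨-swap₁₂ : ∀ a b c → (a ∨ b ∨ c) ≡ (b ∨ a ∨ c)
∨-swap₁₂ a b c = trans (≡-sym (∨-assoc a b c)) (trans (cong (_∨ c) (∨-comm a b)) (∨-assoc b a c))

∧-reverse : ∀ a b c → (a ∧ b ∧ c) ≡ (c ∧ b ∧ a)
∧-reverse a b c = trans (∧-rotate a b c) (cong (c ∧_) (∧-comm a b))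

χ-split : ∀ p q r w → χ ((p ∧ q ∧ r) ∧ w) ≡ χ (p ∧ q) * χ (r ∧ w)
χ-split true  true  r w = ≡-sym (+-identityʳ _)
χ-split true  false r w = refl
χ-split false q     r w = refl

module TrianglesThrough (H : Graph) (W : Fin (n H) × Fin (n H) × Fin (n H) → Bool)
  (W-swap₁₂ : ∀ a b c → W (a , b , c) ≡ W (b , a , c))
  (W-swap₂₃ : ∀ a b c → W (a , b , c) ≡ W (a , c , b)) where

  private
    m = n H
    A = adj H

  clique : Fin m → Fin m → Fin m → Bool
  clique a b c = (A a b ∧ A b c ∧ A a c) ∧ W (a , b , c)

  weight : Fin m → Fin m → Fin m → ℕ
  weight a b c = χ (isTriangle H (a , b , c) ∧ W (a , b , c))

  weight-split : ∀ a b c → weight a b c ≡ χ ((a ≺ b) ∧ (b ≺ c)) * χ (clique a b c)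
  weight-split a b c = χ-split (a ≺ b) (b ≺ c) (A a b ∧ A b c ∧ A a c) (W (a , b , c))

  clique-swap₁₂ : ∀ a b c → clique b a c ≡ clique a b c
  clique-swap₁₂ a b c = cong₂ _∧_ (cong₂ _∧_ (sym H b a) (∧-comm (A a c) (A b c))) (W-swap₁₂ b a c)

  clique-rotate : ∀ a b c → clique b c a ≡ clique a b c
  clique-rotate a b c =
    cong₂ _∧_ (trans (cong₂ (λ u w → A b c ∧ u ∧ w) (sym H c a) (sym H b a)) (∧-rotate (A b c) (A a c) (A a b)))
              (trans (W-swap₂₃ b c a) (W-swap₁₂ b a c))

  clique-swap₂₃ : ∀ a b c → clique a c b ≡ clique a b c
  clique-swap₂₃ a b c =
    cong₂ _∧_ (trans (cong (λ u → A a c ∧ u ∧ A a b) (sym H c b)) (∧-reverse (A a c) (A b c) (A a b)))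
              (W-swap₂₃ a c b)

  clique-irrefl : ∀ a b → (A a b ∧ A b b ∧ A a b) ∧ W (a , b , b) ≡ false
  clique-irrefl a b rewrite irrefl H b with A a b
  ... | true  = refl
  ... | false = refl

  clique-distinct : ∀ {a b c} → T (clique a b c) → a ≢ b × b ≢ c × a ≢ c
  clique-distinct t with Equivalence.to T-∧ (proj₁ (Equivalence.to T-∧ t))
  ... | ab , bc-ac with Equivalence.to T-∧ bc-ac
  ...   | bc , ac = adjacent-distinct H ab , adjacent-distinct H bc , adjacent-distinct H ac

  three-positions : ∀ v x y → weight v x y + weight x v y + weight x y v ≡ χ (x ≺ y) * χ (clique v x y)
  three-positions v x y = begin
    weight v x y + weight x v y + weight x y v
      ≡⟨ cong₂ _+_ (cong₂ _+_ (weight-split v x y)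
                              (trans (weight-split x v y) (cong (λ b → χ ((x ≺ v) ∧ (v ≺ y)) * χ b) (clique-swap₁₂ v x y))))
                   (trans (weight-split x y v) (cong (λ b → χ ((x ≺ y) ∧ (y ≺ v)) * χ b) (clique-rotate v x y))) ⟩
    α * K + β * K + γ * K   ≡⟨ cong (_+ γ * K) (*-distribʳ-+ K α β) ⟨
    (α + β) * K + γ * K     ≡⟨ *-distribʳ-+ K (α + β) γ ⟨
    (α + β + γ) * K         ≡⟨ sorted-if-clique ⟩
    χ (x ≺ y) * K           ∎
    where
    open ≡-Reasoning
    α = χ ((v ≺ x) ∧ (x ≺ y))
    β = χ ((x ≺ v) ∧ (v ≺ y))
    γ = χ ((x ≺ y) ∧ (y ≺ v))
    K = χ (clique v x y)

    sorted-if-clique : (α + β + γ) * K ≡ χ (x ≺ y) * K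
    sorted-if-clique with clique v x y in vxy
    ... | false = trans (*-zeroʳ (α + β + γ)) (≡-sym (*-zeroʳ (χ (x ≺ y))))
    ... | true with clique-distinct (Equivalence.from T-≡ vxy)
    ...   | v≢x , x≢y , v≢y =
      cong (_* 1) (insertion-positions (toℕ v) (toℕ x) (toℕ y)
                     (v≢x ∘ toℕ-injective) (x≢y ∘ toℕ-injective) (v≢y ∘ toℕ-injective))

  contains-split : ∀ v a b c →
    χ (isTriangle H (a , b , c) ∧ contains (a , b , c) v ∧ W (a , b , c))
      ≡ χ (v == a) * weight a b c + χ (v == b) * weight a b c + χ (v == c) * weight a b c
  contains-split v a b c with isTriangle H (a , b , c) in abc
  ... | false = ≡-sym (cong₂ _+_ (cong₂ _+_ (*-zeroʳ (χ (v == a))) (*-zeroʳ (χ (v == b)))) (*-zeroʳ (χ (v == c))))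
  ... | true with triangle-distinct H (Equivalence.from T-≡ abc)
  ...   | a≢b , b≢c , a≢c = begin
    χ (contains (a , b , c) v ∧ w)                        ≡⟨ χ-∧ (contains (a , b , c) v) w ⟩
    χ (contains (a , b , c) v) * χ w                      ≡⟨ cong (_* χ w) (contains-distinct v a b c a≢b b≢c a≢c) ⟩
    (χ (v == a) + χ (v == b) + χ (v == c)) * χ w          ≡⟨ *-distribʳ-+ (χ w) (χ (v == a) + χ (v == b)) (χ (v == c)) ⟩
    (χ (v == a) + χ (v == b)) * χ w + χ (v == c) * χ w
                        ≡⟨ cong (_+ χ (v == c) * χ w) (*-distribʳ-+ (χ w) (χ (v == a)) (χ (v == b))) ⟩
    χ (v == a) * χ w + χ (v == b) * χ w + χ (v == c) * χ w ∎
    where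
    open ≡-Reasoning
    w = W (a , b , c)

  positions-collapse : ∀ v →
    ∑[ a < m ] ∑[ b < m ] ∑[ c < m ] (χ (v == a) * weight a b c + χ (v == b) * weight a b c + χ (v == c) * weight a b c)
      ≡ ∑[ x < m ] ∑[ y < m ] (weight v x y + weight x v y + weight x y v)
  positions-collapse v = begin
    ∑³ (λ a b c → at₁ a b c + at₂ a b c + at₃ a b c)
      ≡⟨ trans (∑³-distrib-+ (λ a b c → at₁ a b c + at₂ a b c) at₃)
               (cong (_+ ∑³ at₃) (∑³-distrib-+ at₁ at₂)) ⟩
    ∑³ at₁ + ∑³ at₂ + ∑³ at₃
      ≡⟨ cong₂ _+_ (cong₂ _+_ collapse₁ collapse₂) collapse₃ ⟩
    ∑² (λ x y → weight v x y) + ∑² (λ x y → weight x v y) + ∑² (λ x y → weight x y v)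
      ≡⟨ trans (∑²-distrib-+ (λ x y → weight v x y + weight x v y) (λ x y → weight x y v))
               (cong (_+ ∑² (λ x y → weight x y v)) (∑²-distrib-+ (λ x y → weight v x y) (λ x y → weight x v y))) ⟨
    ∑² (λ x y → weight v x y + weight x v y + weight x y v) ∎
    where
    open ≡-Reasoning
    ∑² : (Fin m → Fin m → ℕ) → ℕ
    ∑² f = ∑[ x < m ] ∑[ y < m ] f x y
    ∑³ : (Fin m → Fin m → Fin m → ℕ) → ℕ
    ∑³ f = ∑[ a < m ] ∑[ b < m ] ∑[ c < m ] f a b c

    at₁ at₂ at₃ : Fin m → Fin m → Fin m → ℕ
    at₁ a b c = χ (v == a) * weight a b c
    at₂ a b c = χ (v == b) * weight a b c
    at₃ a b c = χ (v == c) * weight a b c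

    collapse₁ : ∑³ at₁ ≡ ∑² (λ x y → weight v x y)
    collapse₁ = trans (sum-cong-≗ λ a → trans (sum-cong-≗ λ b → ∑-*ˡ (χ (v == a)) (weight a b))
                                               (∑-*ˡ {m} (χ (v == a)) _))
                      (∑-δ v (λ a → ∑² (weight a)))

    collapse₂ : ∑³ at₂ ≡ ∑² (λ x y → weight x v y)
    collapse₂ = sum-cong-≗ λ a → trans (sum-cong-≗ λ b → ∑-*ˡ (χ (v == b)) (weight a b))
                                       (∑-δ v (λ b → ∑[ c < m ] weight a b c))

    collapse₃ : ∑³ at₃ ≡ ∑² (λ x y → weight x y v)
    collapse₃ = sum-cong-≗ λ a → sum-cong-≗ λ b → ∑-δ v (weight a b)

  triangles-through : (v : Fin m) →
    2 * count (λ t → isTriangle H t ∧ contains t v ∧ W t) (triples m) ≡ ∑[ x < m ] ∑[ y < m ] χ (clique v x y)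
  triangles-through v = begin
    2 * count (λ t → isTriangle H t ∧ contains t v ∧ W t) (triples m)
      ≡⟨ cong (2 *_) (count-triples {m} _) ⟩
    2 * ∑[ a < m ] ∑[ b < m ] ∑[ c < m ] χ (isTriangle H (a , b , c) ∧ contains (a , b , c) v ∧ W (a , b , c))
      ≡⟨ cong (2 *_) (sum-cong-≗ λ a → sum-cong-≗ λ b → sum-cong-≗ λ c → contains-split v a b c) ⟩
    2 * ∑[ a < m ] ∑[ b < m ] ∑[ c < m ] (χ (v == a) * weight a b c + χ (v == b) * weight a b c + χ (v == c) * weight a b c)
      ≡⟨ cong (2 *_) (positions-collapse v) ⟩
    2 * ∑[ x < m ] ∑[ y < m ] (weight v x y + weight x v y + weight x y v)
      ≡⟨ cong (2 *_) (sum-cong-≗ λ x → sum-cong-≗ λ y → three-positions v x y) ⟩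
    2 * ∑[ x < m ] ∑[ y < m ] (χ (x ≺ y) * χ (clique v x y))
      ≡⟨ ∑-unordered-pairs (λ x y → χ (clique v x y))
           (λ x y → cong χ (≡-sym (clique-swap₂₃ v x y))) (λ x → cong χ (clique-irrefl v x)) ⟩
    ∑[ x < m ] ∑[ y < m ] χ (clique v x y) ∎
    where open ≡-Reasoning

-- Deleting the loops of a reflexive symmetric relation σ on Fin ℓ gives the
-- adjacency  α k l = not (k == l) ∧ σ k l  (the line graph arises this way,
-- with σ = "shares an endpoint").  Ordered α-adjacent pairs of α-neighbours of
-- v are compared with all σ-triangles (v , k , l), which may have coincidences.
module Loopless {ℓ} (σ : Fin ℓ → Fin ℓ → Bool)
  (σ-refl : ∀ k → σ k k ≡ true) (σ-sym : ∀ k l → σ k l ≡ σ l k) (v : Fin ℓ) where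

  α : Fin ℓ → Fin ℓ → Bool
  α k l = not (k == l) ∧ σ k l

  -- The coincidences k = v, l = v and k = l each contribute a σ-neighbour of
  -- v; the triple coincidence k = l = v is counted three times instead of once.
  coincidences : ∀ k l →
    χ (α v k ∧ α k l ∧ α v l) + χ (v == k) * χ (σ v l) + χ (v == l) * χ (σ v k) + χ (k == l) * χ (σ v k)
      ≡ χ (σ v k ∧ σ k l ∧ σ v l) + χ (v == k) * (χ (v == l) * 2)
  coincidences k l with v ≟ k | v ≟ l | k ≟ l
  ... | yes v≡k  | yes v≡l  | no k≢l   = ⊥-elim (k≢l (trans (≡-sym v≡k) v≡l))
  ... | yes v≡k  | no v≢l   | yes k≡l  = ⊥-elim (v≢l (trans v≡k k≡l))
  ... | no v≢k   | yes v≡l  | yes k≡l  = ⊥-elim (v≢k (trans v≡l (≡-sym k≡l)))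
  ... | yes refl | yes refl | yes _ rewrite σ-refl v = refl
  ... | yes refl | no _     | no _ rewrite σ-refl v with σ v l
  ...   | true  = refl
  ...   | false = refl
  coincidences k l | no _ | yes refl | no _ rewrite σ-refl v | σ-sym k v with σ v k
  ...   | true  = refl
  ...   | false = refl
  coincidences k l | no _ | no _ | yes refl rewrite σ-refl k with σ v k
  ...   | true  = refl
  ...   | false = refl
  coincidences k l | no _ | no _ | no _ with σ v k ∧ σ k l ∧ σ v l
  ...   | true  = refl
  ...   | false = refl

  loopless-pairs :
    ∑[ k < ℓ ] ∑[ l < ℓ ] χ (α v k ∧ α k l ∧ α v l) + 3 * ∑[ k < ℓ ] χ (σ v k)
      ≡ ∑[ k < ℓ ] ∑[ l < ℓ ] χ (σ v k ∧ σ k l ∧ σ v l) + 2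
  loopless-pairs = begin
    ∑² P + 3 * N                       ≡⟨ three-copies (∑² P) N ⟩
    ∑² P + N + N + N                   ≡⟨ cong₂ _+_ (cong₂ _+_ (cong (∑² P +_) at-v₁) at-v₂) on-diagonal ⟨
    ∑² P + ∑² c₁ + ∑² c₂ + ∑² c₃       ≡⟨ distrib₄ ⟨
    ∑² (λ k l → P k l + c₁ k l + c₂ k l + c₃ k l)
                                       ≡⟨ sum-cong-≗ (λ k → sum-cong-≗ (coincidences k)) ⟩
    ∑² (λ k l → Q k l + χ (v == k) * (χ (v == l) * 2))
                                       ≡⟨ ∑²-distrib-+ Q (λ k l → χ (v == k) * (χ (v == l) * 2)) ⟩
    ∑² Q + ∑² (λ k l → χ (v == k) * (χ (v == l) * 2))
                                       ≡⟨ cong (∑² Q +_) double-at-v ⟩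
    ∑² Q + 2                           ∎
    where
    open ≡-Reasoning
    ∑² : (Fin ℓ → Fin ℓ → ℕ) → ℕ
    ∑² f = ∑[ k < ℓ ] ∑[ l < ℓ ] f k l
    P Q c₁ c₂ c₃ : Fin ℓ → Fin ℓ → ℕ
    P k l = χ (α v k ∧ α k l ∧ α v l)
    Q k l = χ (σ v k ∧ σ k l ∧ σ v l)
    c₁ k l = χ (v == k) * χ (σ v l)
    c₂ k l = χ (v == l) * χ (σ v k)
    c₃ k l = χ (k == l) * χ (σ v k)
    N = ∑[ k < ℓ ] χ (σ v k)

    three-copies : ∀ x y → x + 3 * y ≡ x + y + y + y
    three-copies = solve-∀

    at-v₁ : ∑² c₁ ≡ N
    at-v₁ = trans (sum-cong-≗ λ k → ∑-*ˡ (χ (v == k)) (λ l → χ (σ v l))) (∑-δ v (λ _ → N))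
    at-v₂ : ∑² c₂ ≡ N
    at-v₂ = sum-cong-≗ λ k → ∑-δ v (λ _ → χ (σ v k))
    on-diagonal : ∑² c₃ ≡ N
    on-diagonal = sum-cong-≗ λ k → ∑-δ k (λ _ → χ (σ v k))

    distrib₄ : ∑² (λ k l → P k l + c₁ k l + c₂ k l + c₃ k l) ≡ ∑² P + ∑² c₁ + ∑² c₂ + ∑² c₃
    distrib₄ = trans (∑²-distrib-+ (λ k l → P k l + c₁ k l + c₂ k l) c₃)
               (cong (_+ ∑² c₃) (trans (∑²-distrib-+ (λ k l → P k l + c₁ k l) c₂)
                                       (cong (_+ ∑² c₂) (∑²-distrib-+ P c₁))))

    double-at-v : ∑² (λ k l → χ (v == k) * (χ (v == l) * 2)) ≡ 2
    double-at-v = trans (sum-cong-≗ λ k → ∑-*ˡ (χ (v == k)) (λ l → χ (v == l) * 2))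
                        (trans (∑-δ v (λ _ → ∑[ l < ℓ ] (χ (v == l) * 2))) (∑-δ v (λ _ → 2)))

incident : ∀ {m} → Fin m × Fin m → Fin m → Bool
incident (p , q) a = (a == p) ∨ (a == q)

incident-swap : ∀ {m} (p q a : Fin m) → incident (p , q) a ≡ incident (q , p) a
incident-swap p q a = ∨-comm (a == p) (a == q)

share-incident : ∀ {m} (i j : Fin m) (f : Fin m × Fin m) → share (i , j) f ≡ (incident f i ∨ incident f j)
share-incident i j (p , q) = ≡-sym (∨-assoc (i == p) (i == q) ((j == p) ∨ (j == q)))

share-same-start : ∀ {m} (a b c : Fin m) → share (a , b) (a , c) ≡ true
share-same-start a b c rewrite ==-refl a = refl

share-at-endpoint : ∀ {m} (a b c : Fin m) → share (a , b) (b , c) ≡ true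
share-at-endpoint a b c rewrite ==-refl b with a == b | a == c
... | true  | _     = refl
... | false | true  = refl
... | false | false = refl

share-off-endpoint : ∀ {m} {a b w : Fin m} → a ≢ b → w ≢ b →
  ∀ w′ → share (a , w) (b , w′) ≡ ((a == w′) ∨ (w == w′))
share-off-endpoint {a = a} {b} {w} a≢b w≢b w′ rewrite ==-false a≢b | ==-false w≢b =
  cong (a == w′ ∨_) (∨-identityˡ (w == w′))

share-swapʳ : ∀ {m} (f : Fin m × Fin m) (p q : Fin m) → share f (p , q) ≡ share f (q , p)
share-swapʳ (a , b) p q = begin
  share (a , b) (p , q)                          ≡⟨ share-incident a b (p , q) ⟩
  incident (p , q) a ∨ incident (p , q) b        ≡⟨ cong₂ _∨_ (incident-swap p q a) (incident-swap p q b) ⟩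
  incident (q , p) a ∨ incident (q , p) b        ≡⟨ share-incident a b (q , p) ⟨
  share (a , b) (q , p)                          ∎
  where open ≡-Reasoning

share-swapˡ : ∀ {m} (p q : Fin m) (g : Fin m × Fin m) → share (p , q) g ≡ share (q , p) g
share-swapˡ p q g = trans (share-sym (p , q) g) (trans (share-swapʳ g p q) (share-sym g (q , p)))

module EdgeSums (G : Graph) where

  private
    m = n G
    A = adj G

  isEdge : Fin m → Fin m → Bool
  isEdge p q = (p ≺ q) ∧ A p q

  ∑E : (Fin m × Fin m → ℕ) → ℕ
  ∑E g = ∑[ p < m ] ∑[ q < m ] (χ (isEdge p q) * g (p , q))

  ∑-edges : (g : Fin m × Fin m → ℕ) → ∑[ k < length (edges G) ] g (lookup (edges G) k) ≡ ∑E g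
  ∑-edges g = trans (listSum-lookup g (edges G))
                    (trans (listSum-filter g (λ f → isEdge (proj₁ f) (proj₂ f)) (cartesianProduct (allFin m) (allFin m)))
                           (listSum-allFin² {m} _))

  edges-adjacent : (k : Fin (length (edges G))) → T (A (proj₁ (lookup (edges G) k)) (proj₂ (lookup (edges G) k)))
  edges-adjacent k = proj₂ (Equivalence.to T-∧ (proj₂ (∈-filter⁻ (λ f → T? (isEdge (proj₁ f) (proj₂ f)))
                                                              {xs = cartesianProduct (allFin m) (allFin m)} (∈-lookup k))))

  ∑E-cong : {g h : Fin m × Fin m → ℕ} → (∀ f → g f ≡ h f) → ∑E g ≡ ∑E h
  ∑E-cong g≡h = sum-cong-≗ λ p → sum-cong-≗ λ q → cong (χ (isEdge p q) *_) (g≡h (p , q))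

  ∑E-distrib-+ : (g h : Fin m × Fin m → ℕ) → ∑E (λ f → g f + h f) ≡ ∑E g + ∑E h
  ∑E-distrib-+ g h =
    trans (sum-cong-≗ λ p → sum-cong-≗ λ q → *-distribˡ-+ (χ (isEdge p q)) (g (p , q)) (h (p , q)))
          (∑²-distrib-+ {m} _ _)

  ∑E-at : (a : Fin m) (h : Fin m × Fin m → ℕ) → (∀ p q → h (p , q) ≡ h (q , p)) →
    ∑E (λ f → χ (incident f a) * h f) ≡ ∑[ w < m ] (χ (A a w) * h (a , w))
  ∑E-at a h h-sym = begin
    ∑E (λ f → χ (incident f a) * h f)
      ≡⟨ sum-cong-≗ (λ p → sum-cong-≗ (endpoint-split p)) ⟩
    ∑[ p < m ] ∑[ q < m ] (χ (a == p) * e p q + χ (a == q) * e p q)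
      ≡⟨ ∑²-distrib-+ (λ p q → χ (a == p) * e p q) (λ p q → χ (a == q) * e p q) ⟩
    ∑[ p < m ] ∑[ q < m ] (χ (a == p) * e p q) + ∑[ p < m ] ∑[ q < m ] (χ (a == q) * e p q)
      ≡⟨ cong₂ _+_ (trans (sum-cong-≗ λ p → ∑-*ˡ (χ (a == p)) (e p)) (∑-δ a (λ p → ∑[ q < m ] e p q)))
                   (sum-cong-≗ λ p → ∑-δ a (e p)) ⟩
    ∑[ w < m ] e a w + ∑[ w < m ] e w a
      ≡⟨ ∑-distrib-+ (e a) (λ w → e w a) ⟨
    ∑[ w < m ] (e a w + e w a)
      ≡⟨ sum-cong-≗ both-orientations ⟩
    ∑[ w < m ] (χ (A a w) * h (a , w)) ∎
    where
    open ≡-Reasoning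
    e : Fin m → Fin m → ℕ
    e p q = χ (isEdge p q) * h (p , q)

    endpoint-split : ∀ p q → χ (isEdge p q) * (χ (incident (p , q) a) * h (p , q)) ≡ χ (a == p) * e p q + χ (a == q) * e p q
    endpoint-split p q with a ≟ p | a ≟ q
    ... | yes refl | yes refl rewrite <ᵇ-false (<-irrefl {toℕ a} refl) = refl
    ... | yes _    | no _     = one-term (χ (isEdge p q)) (h (p , q))
      where
      one-term : ∀ x y → x * (1 * y) ≡ 1 * (x * y) + 0
      one-term = solve-∀
    ... | no _     | yes _    = one-term (χ (isEdge p q)) (h (p , q))
      where
      one-term : ∀ x y → x * (1 * y) ≡ 1 * (x * y)
      one-term = solve-∀
    ... | no _     | no _     = *-zeroʳ (χ (isEdge p q))

    both-orientations : ∀ w → e a w + e w a ≡ χ (A a w) * h (a , w)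
    both-orientations w rewrite h-sym w a | sym G w a with A a w in aw
    ... | false rewrite ∧-zeroʳ (a ≺ w) | ∧-zeroʳ (w ≺ a) = refl
    ... | true rewrite ∧-identityʳ (a ≺ w) | ∧-identityʳ (w ≺ a) =
      trans (≡-sym (*-distribʳ-+ (h (a , w)) (χ (a ≺ w)) (χ (w ≺ a))))
            (cong (_* h (a , w)) (≺-total a w (adjacent-distinct G (Equivalence.from T-≡ aw))))

  d : Fin m → ℕ
  d a = ∑[ w < m ] χ (A a w)

  d⁻ : Fin m → Fin m → ℕ
  d⁻ a b = ∑[ w < m ] (χ (A a w) * χ (not (w == b)))

  common : Fin m → Fin m → ℕ
  common a b = ∑[ w < m ] (χ (A a w) * χ (A b w))

  deg≡d : ∀ a → deg G a ≡ d a
  deg≡d a = trans (count≡listSum (A a) (allFin m)) (listSum-allFin {m} _)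

  d≡d⁻+1 : ∀ {a b} → T (A a b) → d a ≡ d⁻ a b + 1
  d≡d⁻+1 {a} {b} ab = begin
    ∑[ w < m ] χ (A a w)                                              ≡⟨ sum-cong-≗ split ⟩
    ∑[ w < m ] (χ (A a w) * χ (not (w == b)) + χ (w == b) * 1)        ≡⟨ ∑-distrib-+ (λ w → χ (A a w) * χ (not (w == b))) _ ⟩
    d⁻ a b + ∑[ w < m ] (χ (w == b) * 1)                              ≡⟨ cong (d⁻ a b +_) (∑-δ′ b (λ _ → 1)) ⟩
    d⁻ a b + 1                                                        ∎
    where
    open ≡-Reasoning
    split : ∀ w → χ (A a w) ≡ χ (A a w) * χ (not (w == b)) + χ (w == b) * 1
    split w with w ≟ b
    ... | yes refl rewrite Equivalence.to T-≡ ab = refl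
    ... | no _     = ≡-sym (trans (+-identityʳ _) (*-identityʳ _))

  deg-pred : ∀ {a b} → T (A a b) → deg G a ∸ 1 ≡ d⁻ a b
  deg-pred {a} {b} ab = trans (cong (_∸ 1) (trans (deg≡d a) (d≡d⁻+1 ab))) (m+n∸n≡m (d⁻ a b) 1)

  common-sym : ∀ a b → common a b ≡ common b a
  common-sym a b = sum-cong-≗ λ w → *-comm (χ (A a w)) (χ (A b w))

  own-sum : ∀ a w → ∑[ w′ < m ] (χ (A a w′) * χ (share (a , w) (a , w′))) ≡ d a
  own-sum a w = sum-cong-≗ λ w′ →
    trans (cong (λ c → χ (A a w′) * χ c) (share-same-start a w w′)) (*-identityʳ (χ (A a w′)))

  cross-sum-same : ∀ a b → ∑[ w′ < m ] (χ (A b w′) * χ (share (a , b) (b , w′))) ≡ d b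
  cross-sum-same a b = sum-cong-≗ λ w′ →
    trans (cong (λ c → χ (A b w′) * χ c) (share-at-endpoint a b w′)) (*-identityʳ (χ (A b w′)))

  -- Edges at b meeting the edge  a w , for neighbours b ≠ w of a: the edge  b a
  -- and possibly  b w .
  cross-sum-other : ∀ {a b w} → T (A a b) → T (A a w) → w ≢ b →
    ∑[ w′ < m ] (χ (A b w′) * χ (share (a , w) (b , w′))) ≡ 1 + χ (A b w)
  cross-sum-other {a} {b} {w} ab aw w≢b = begin
    ∑[ w′ < m ] (χ (A b w′) * χ (share (a , w) (b , w′)))
      ≡⟨ sum-cong-≗ endpoints ⟩
    ∑[ w′ < m ] (χ (a == w′) * χ (A b w′) + χ (w == w′) * χ (A b w′))
      ≡⟨ ∑-distrib-+ (λ w′ → χ (a == w′) * χ (A b w′)) (λ w′ → χ (w == w′) * χ (A b w′)) ⟩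
    ∑[ w′ < m ] (χ (a == w′) * χ (A b w′)) + ∑[ w′ < m ] (χ (w == w′) * χ (A b w′))
      ≡⟨ cong₂ _+_ (∑-δ a (λ w′ → χ (A b w′))) (∑-δ w (λ w′ → χ (A b w′))) ⟩
    χ (A b a) + χ (A b w)
      ≡⟨ cong (λ c → χ c + χ (A b w)) (trans (sym G b a) (Equivalence.to T-≡ ab)) ⟩
    1 + χ (A b w) ∎
    where
    open ≡-Reasoning
    a≢w : a ≢ w
    a≢w = adjacent-distinct G aw

    endpoints : ∀ w′ → χ (A b w′) * χ (share (a , w) (b , w′)) ≡ χ (a == w′) * χ (A b w′) + χ (w == w′) * χ (A b w′)
    endpoints w′ rewrite share-off-endpoint (adjacent-distinct G ab) w≢b w′ with a ≟ w′ | w ≟ w′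
    ... | yes a≡w′ | yes w≡w′ = ⊥-elim (a≢w (trans a≡w′ (≡-sym w≡w′)))
    ... | yes _    | no _     = at-a (χ (A b w′))
      where
      at-a : ∀ x → x * 1 ≡ 1 * x + 0
      at-a = solve-∀
    ... | no _     | yes _    = at-w (χ (A b w′))
      where
      at-w : ∀ x → x * 1 ≡ 1 * x
      at-w = solve-∀
    ... | no _     | no _     = *-zeroʳ (χ (A b w′))

  neighbour-sum : ∀ {a b} → T (A a b) → (X : Fin m → ℕ) → X b ≡ d b →
    (∀ w → T (A a w) → w ≢ b → X w ≡ 1 + χ (A b w)) →
    ∑[ w < m ] (χ (A a w) * X w) ≡ d b + (d⁻ a b + common a b)
  neighbour-sum {a} {b} ab X X-at-b X-elsewhere = begin
    ∑[ w < m ] (χ (A a w) * X w)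
      ≡⟨ sum-cong-≗ at-or-off-b ⟩
    ∑[ w < m ] (χ (w == b) * d b + (χ (A a w) * χ (not (w == b)) + χ (A a w) * χ (A b w)))
      ≡⟨ ∑-distrib-+ (λ w → χ (w == b) * d b) _ ⟩
    ∑[ w < m ] (χ (w == b) * d b) + ∑[ w < m ] (χ (A a w) * χ (not (w == b)) + χ (A a w) * χ (A b w))
      ≡⟨ cong₂ _+_ (∑-δ′ b (λ _ → d b)) (∑-distrib-+ (λ w → χ (A a w) * χ (not (w == b))) _) ⟩
    d b + (d⁻ a b + common a b) ∎
    where
    open ≡-Reasoning
    at-or-off-b : ∀ w → χ (A a w) * X w ≡ χ (w == b) * d b + (χ (A a w) * χ (not (w == b)) + χ (A a w) * χ (A b w))
    at-or-off-b w with w ≟ b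
    ... | yes refl rewrite Equivalence.to T-≡ ab | irrefl G w | X-at-b = at-b (d w)
      where
      at-b : ∀ x → 1 * x ≡ 1 * x + (1 * 0 + 1 * 0)
      at-b = solve-∀
    ... | no w≢b with A a w in aw
    ...   | false = refl
    ...   | true rewrite X-elsewhere w (Equivalence.from T-≡ aw) w≢b = off-b (χ (A b w)) (d b)
      where
      off-b : ∀ x y → 1 * (1 + x) ≡ 0 * y + (1 * 1 + 1 * x)
      off-b = solve-∀

  neighbour-total : ∀ {a b} → T (A a b) → (r : Fin m → ℕ) →
    (∀ w → T (A a w) → r w + 1 ≡ d a + ∑[ w′ < m ] (χ (A b w′) * χ (share (a , w) (b , w′)))) →
    ∑[ w < m ] (χ (A a w) * r w) + d a ≡ d a * d a + (d b + (d⁻ a b + common a b))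
  neighbour-total {a} {b} ab r r-spec = begin
    ∑[ w < m ] (χ (A a w) * r w) + d a
      ≡⟨ ∑-distrib-+ (λ w → χ (A a w) * r w) (λ w → χ (A a w)) ⟨
    ∑[ w < m ] (χ (A a w) * r w + χ (A a w))
      ≡⟨ sum-cong-≗ per-neighbour ⟩
    ∑[ w < m ] (χ (A a w) * d a + χ (A a w) * X w)
      ≡⟨ ∑-distrib-+ (λ w → χ (A a w) * d a) (λ w → χ (A a w) * X w) ⟩
    ∑[ w < m ] (χ (A a w) * d a) + ∑[ w < m ] (χ (A a w) * X w)
      ≡⟨ cong₂ _+_ (∑-*ʳ (d a) (λ w → χ (A a w)))
                   (neighbour-sum ab X (cross-sum-same a b) (λ w aw w≢b → cross-sum-other ab aw w≢b)) ⟩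
    d a * d a + (d b + (d⁻ a b + common a b)) ∎
    where
    open ≡-Reasoning
    X : Fin m → ℕ
    X w = ∑[ w′ < m ] (χ (A b w′) * χ (share (a , w) (b , w′)))

    per-neighbour : ∀ w → χ (A a w) * r w + χ (A a w) ≡ χ (A a w) * d a + χ (A a w) * X w
    per-neighbour w with A a w in aw
    ... | false = refl
    ... | true  = trans (cong (_+ 1) (*-identityˡ (r w)))
                  (trans (r-spec w (Equivalence.from T-≡ aw))
                         (≡-sym (cong₂ _+_ (*-identityˡ (d a)) (*-identityˡ (X w)))))

  module AtEdge (i j : Fin m) (ij : T (A i j)) where

    ji : T (A j i)
    ji = subst T (sym G i j) ij

    j≢i : j ≢ i
    j≢i j≡i = adjacent-distinct G ij (≡-sym j≡i)

    -- The only edge incident to both i and j is  i j  itself.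
    ∑E-both : (h : Fin m × Fin m → ℕ) → (∀ p q → h (p , q) ≡ h (q , p)) →
      ∑E (λ f → χ (incident f i ∧ incident f j) * h f) ≡ h (i , j)
    ∑E-both h h-sym = begin
      ∑E (λ f → χ (incident f i ∧ incident f j) * h f)
        ≡⟨ ∑E-cong (λ f → trans (cong (_* h f) (χ-∧ (incident f i) (incident f j)))
                                (*-assoc (χ (incident f i)) (χ (incident f j)) (h f))) ⟩
      ∑E (λ f → χ (incident f i) * (χ (incident f j) * h f))
        ≡⟨ ∑E-at i (λ f → χ (incident f j) * h f)
                 (λ p q → cong₂ (λ b y → χ b * y) (incident-swap p q j) (h-sym p q)) ⟩
      ∑[ w < m ] (χ (A i w) * (χ ((j == i) ∨ (j == w)) * h (i , w)))
        ≡⟨ sum-cong-≗ (λ w → reorder w) ⟩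
      ∑[ w < m ] (χ (j == w) * (χ (A i w) * h (i , w)))
        ≡⟨ ∑-δ j (λ w → χ (A i w) * h (i , w)) ⟩
      χ (A i j) * h (i , j)
        ≡⟨ cong (λ b → χ b * h (i , j)) (Equivalence.to T-≡ ij) ⟩
      1 * h (i , j)
        ≡⟨ *-identityˡ (h (i , j)) ⟩
      h (i , j) ∎
      where
      open ≡-Reasoning
      reorder : ∀ w → χ (A i w) * (χ ((j == i) ∨ (j == w)) * h (i , w)) ≡ χ (j == w) * (χ (A i w) * h (i , w))
      reorder w rewrite ==-false j≢i = swap (χ (A i w)) (χ (j == w)) (h (i , w))
        where
        swap : ∀ x y z → x * (y * z) ≡ y * (x * z)
        swap = solve-∀

    -- The edges meeting  i j  are those at i together with those at j, where
    -- i j itself occurs in both groups.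
    ∑E-share : (h : Fin m × Fin m → ℕ) → (∀ p q → h (p , q) ≡ h (q , p)) →
      ∑E (λ f → χ (share (i , j) f) * h f) + h (i , j)
        ≡ ∑[ w < m ] (χ (A i w) * h (i , w)) + ∑[ w < m ] (χ (A j w) * h (j , w))
    ∑E-share h h-sym = begin
      ∑E (λ f → χ (share (i , j) f) * h f) + h (i , j)
        ≡⟨ cong (∑E (λ f → χ (share (i , j) f) * h f) +_) (∑E-both h h-sym) ⟨
      ∑E (λ f → χ (share (i , j) f) * h f) + ∑E (λ f → χ (incident f i ∧ incident f j) * h f)
        ≡⟨ ∑E-distrib-+ (λ f → χ (share (i , j) f) * h f) (λ f → χ (incident f i ∧ incident f j) * h f) ⟨
      ∑E (λ f → χ (share (i , j) f) * h f + χ (incident f i ∧ incident f j) * h f)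
        ≡⟨ ∑E-cong inclusion-exclusion ⟩
      ∑E (λ f → χ (incident f i) * h f + χ (incident f j) * h f)
        ≡⟨ ∑E-distrib-+ (λ f → χ (incident f i) * h f) (λ f → χ (incident f j) * h f) ⟩
      ∑E (λ f → χ (incident f i) * h f) + ∑E (λ f → χ (incident f j) * h f)
        ≡⟨ cong₂ _+_ (∑E-at i h h-sym) (∑E-at j h h-sym) ⟩
      ∑[ w < m ] (χ (A i w) * h (i , w)) + ∑[ w < m ] (χ (A j w) * h (j , w)) ∎
      where
      open ≡-Reasoning
      inclusion-exclusion : ∀ f → χ (share (i , j) f) * h f + χ (incident f i ∧ incident f j) * h f
                                ≡ χ (incident f i) * h f + χ (incident f j) * h f
      inclusion-exclusion f rewrite share-incident i j f =
        trans (≡-sym (*-distribʳ-+ (h f) (χ (incident f i ∨ incident f j)) (χ (incident f i ∧ incident f j))))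
        (trans (cong (_* h f) (χ-∨-∧ (incident f i) (incident f j)))
               (*-distribʳ-+ (h f) (χ (incident f i)) (χ (incident f j))))

    e : Fin m × Fin m
    e = (i , j)

    N : ℕ
    N = ∑E (λ f → χ (share e f))

    R : Fin m × Fin m → ℕ
    R f = ∑E (λ g → χ (share e g) * χ (share f g))

    Q : ℕ
    Q = ∑E (λ f → χ (share e f) * R f)

    S : Fin m → ℕ
    S a = ∑[ w < m ] (χ (A a w) * R (a , w))

    -- Edges meeting e: those at i plus those at j, e being counted twice.
    N-count : N + 1 ≡ d i + d j
    N-count = begin
      N + 1                                                      ≡⟨ cong (_+ 1) (∑E-cong λ f → ≡-sym (*-identityʳ (χ (share e f)))) ⟩
      ∑E (λ f → χ (share e f) * 1) + 1                           ≡⟨ ∑E-share (λ _ → 1) (λ _ _ → refl) ⟩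
      ∑[ w < m ] (χ (A i w) * 1) + ∑[ w < m ] (χ (A j w) * 1)    ≡⟨ cong₂ _+_ (sum-cong-≗ λ w → *-identityʳ (χ (A i w)))
                                                                                (sum-cong-≗ λ w → *-identityʳ (χ (A j w))) ⟩
      d i + d j                                                  ∎
      where open ≡-Reasoning

    R-sym : ∀ p q → R (p , q) ≡ R (q , p)
    R-sym p q = ∑E-cong λ g → cong (λ c → χ (share e g) * χ c) (share-swapˡ p q g)

    R-at-e : R e ≡ N
    R-at-e = ∑E-cong λ g → χ-idem (share e g)

    -- Pairs (f , g): split by the endpoint of e lying on f.
    Q-count : Q + N ≡ S i + S j
    Q-count = trans (cong (Q +_) (≡-sym R-at-e)) (∑E-share R R-sym)

    R-split : ∀ f → R f + χ (share f e)
      ≡ ∑[ w′ < m ] (χ (A i w′) * χ (share f (i , w′))) + ∑[ w′ < m ] (χ (A j w′) * χ (share f (j , w′)))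
    R-split f = ∑E-share (λ g → χ (share f g)) (λ p q → cong χ (share-swapʳ f p q))

    -- For a neighbour w of i:  R(i , w) + 1 = R(i , w) + [i w meets e]
    -- = (edges at i meeting  i w ) + (edges at j meeting  i w );  likewise at j.
    S-count-i : S i + d i ≡ d i * d i + (d j + (d⁻ i j + common i j))
    S-count-i = neighbour-total ij (λ w → R (i , w)) λ w _ →
      trans (cong (λ c → R (i , w) + χ c) (≡-sym (share-same-start i w j)))
            (trans (R-split (i , w))
                   (cong (_+ ∑[ w′ < m ] (χ (A j w′) * χ (share (i , w) (j , w′)))) (own-sum i w)))

    S-count-j : S j + d j ≡ d j * d j + (d i + (d⁻ j i + common j i))
    S-count-j = neighbour-total ji (λ w → R (j , w)) λ w _ →
      trans (cong (λ c → R (j , w) + χ c) (≡-sym (trans (share-sym (j , w) e) (share-at-endpoint i j w))))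
            (trans (R-split (j , w))
                   (trans (+-comm (∑[ w′ < m ] (χ (A i w′) * χ (share (j , w) (i , w′)))) _)
                          (cong (_+ ∑[ w′ < m ] (χ (A i w′) * χ (share (j , w) (i , w′)))) (own-sum j w))))

    -- In a triangle  i x y  the vertex j ≠ i is x or y.
    third-vertex : ∀ x y → χ ((A i x ∧ A x y ∧ A i y) ∧ ((j == i) ∨ (j == x) ∨ (j == y)))
                         ≡ χ (j == x) * (χ (A i y) * χ (A j y)) + χ (j == y) * (χ (A i x) * χ (A j x))
    third-vertex x y rewrite ==-false j≢i with j ≟ x | j ≟ y
    ... | yes refl | yes refl rewrite irrefl G j | Equivalence.to T-≡ ij = refl
    ... | yes refl | no _     rewrite Equivalence.to T-≡ ij = x-is-j (A j y) (A i y)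
      where
      x-is-j : ∀ a b → χ ((a ∧ b) ∧ true) ≡ 1 * (χ b * χ a) + 0
      x-is-j true  true  = refl
      x-is-j true  false = refl
      x-is-j false true  = refl
      x-is-j false false = refl
    ... | no _     | yes refl rewrite Equivalence.to T-≡ ij | sym G x j = y-is-j (A i x) (A j x)
      where
      y-is-j : ∀ a b → χ ((a ∧ b ∧ true) ∧ true) ≡ 1 * (χ a * χ b)
      y-is-j true  true  = refl
      y-is-j true  false = refl
      y-is-j false b     = refl
    ... | no _     | no _     = cong χ (∧-zeroʳ (A i x ∧ A x y ∧ A i y))

    triangles-at-edge : 2 * triEdge G i j ≡ common i j + common i j
    triangles-at-edge = begin
      2 * triEdge G i j
        ≡⟨ Through.triangles-through i ⟩
      ∑[ x < m ] ∑[ y < m ] χ ((A i x ∧ A x y ∧ A i y) ∧ ((j == i) ∨ (j == x) ∨ (j == y)))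
        ≡⟨ sum-cong-≗ (λ x → sum-cong-≗ (third-vertex x)) ⟩
      ∑[ x < m ] ∑[ y < m ] (χ (j == x) * (χ (A i y) * χ (A j y)) + χ (j == y) * (χ (A i x) * χ (A j x)))
        ≡⟨ ∑²-distrib-+ (λ x y → χ (j == x) * (χ (A i y) * χ (A j y))) (λ x y → χ (j == y) * (χ (A i x) * χ (A j x))) ⟩
      ∑[ x < m ] ∑[ y < m ] (χ (j == x) * (χ (A i y) * χ (A j y)))
        + ∑[ x < m ] ∑[ y < m ] (χ (j == y) * (χ (A i x) * χ (A j x)))
        ≡⟨ cong₂ _+_ (trans (sum-cong-≗ λ x → ∑-*ˡ (χ (j == x)) (λ y → χ (A i y) * χ (A j y))) (∑-δ j (λ _ → common i j)))
                     (sum-cong-≗ λ x → ∑-δ j (λ _ → χ (A i x) * χ (A j x))) ⟩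
      common i j + common i j ∎
      where
      open ≡-Reasoning
      module Through = TrianglesThrough G (λ t → contains t j)
                         (λ a b c → ∨-swap₁₂ (j == a) (j == b) (j == c))
                         (λ a b c → cong ((j == a) ∨_) (∨-comm (j == b) (j == c)))

two-choose-two : ∀ a → 2 * (a C 2) + a ≡ a * a
two-choose-two zero    = refl
two-choose-two (suc a) = begin
  2 * (suc a C 2) + suc a          ≡⟨ cong (λ x → 2 * x + suc a) (nCk+nC[k+1]≡[n+1]C[k+1] a 1) ⟨
  2 * (a C 1 + a C 2) + suc a      ≡⟨ cong (λ x → 2 * (x + a C 2) + suc a) (nC1≡n a) ⟩
  2 * (a + a C 2) + suc a          ≡⟨ regroup a (a C 2) ⟩
  (2 * (a C 2) + a) + (2 * a + 1)  ≡⟨ cong (_+ (2 * a + 1)) (two-choose-two a) ⟩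
  a * a + (2 * a + 1)              ≡⟨ square a ⟩
  suc a * suc a                    ∎
  where
  open ≡-Reasoning
  regroup : ∀ a c → 2 * (a + c) + suc a ≡ (2 * c + a) + (2 * a + 1)
  regroup = solve-∀
  square : ∀ a → a * a + (2 * a + 1) ≡ suc a * suc a
  square = solve-∀

twice-count : ∀ {P N Q Sᵢ Sⱼ dᵢ dⱼ aᵢ aⱼ c c′} →
  2 * P + 3 * N ≡ Q + 2 → N + 1 ≡ dᵢ + dⱼ → Q + N ≡ Sᵢ + Sⱼ →
  Sᵢ + dᵢ ≡ dᵢ * dᵢ + (dⱼ + (aᵢ + c)) → Sⱼ + dⱼ ≡ dⱼ * dⱼ + (dᵢ + (aⱼ + c′)) →
  dᵢ ≡ aᵢ + 1 → dⱼ ≡ aⱼ + 1 → c′ ≡ c →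
  2 * P + (aᵢ + aⱼ) ≡ aᵢ * aᵢ + aⱼ * aⱼ + (c + c)
twice-count {P} {N} {Q} {Sᵢ} {Sⱼ} {aᵢ = a} {b} {c} tot n q sᵢ sⱼ refl refl refl =
  +-cancelʳ-≡ (4 * N + (a + 1) + (b + 1)) _ _ (begin
  2 * P + (a + b) + (4 * N + (a + 1) + (b + 1))
    ≡⟨ e₁ P N a b ⟩
  (2 * P + 3 * N) + N + (a + 1) + (b + 1) + (a + b)
    ≡⟨ cong (λ x → x + N + (a + 1) + (b + 1) + (a + b)) tot ⟩
  (Q + 2) + N + (a + 1) + (b + 1) + (a + b)
    ≡⟨ e₂ Q N a b ⟩
  (Q + N) + (a + 1) + (b + 1) + (a + b + 2)
    ≡⟨ cong (λ x → x + (a + 1) + (b + 1) + (a + b + 2)) q ⟩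
  (Sᵢ + Sⱼ) + (a + 1) + (b + 1) + (a + b + 2)
    ≡⟨ e₃ Sᵢ Sⱼ (a + 1) (b + 1) (a + b + 2) ⟩
  (Sᵢ + (a + 1)) + (Sⱼ + (b + 1)) + (a + b + 2)
    ≡⟨ cong₂ (λ x y → x + y + (a + b + 2)) sᵢ sⱼ ⟩
  ((a + 1) * (a + 1) + ((b + 1) + (a + c))) + ((b + 1) * (b + 1) + ((a + 1) + (b + c))) + (a + b + 2)
    ≡⟨ e₄ a b c ⟩
  a * a + b * b + (c + c) + (4 * (a + b + 1) + (a + 1) + (b + 1))
    ≡⟨ cong (λ x → a * a + b * b + (c + c) + (4 * x + (a + 1) + (b + 1))) N≡ ⟨
  a * a + b * b + (c + c) + (4 * N + (a + 1) + (b + 1)) ∎)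
  where
  open ≡-Reasoning
  N≡ : N ≡ a + b + 1
  N≡ = +-cancelʳ-≡ 1 N (a + b + 1) (trans n (shift a b))
    where
    shift : ∀ a b → a + 1 + (b + 1) ≡ a + b + 1 + 1
    shift = solve-∀

  e₁ : ∀ P N a b → 2 * P + (a + b) + (4 * N + (a + 1) + (b + 1)) ≡ (2 * P + 3 * N) + N + (a + 1) + (b + 1) + (a + b)
  e₁ = solve-∀
  e₂ : ∀ Q N a b → (Q + 2) + N + (a + 1) + (b + 1) + (a + b) ≡ (Q + N) + (a + 1) + (b + 1) + (a + b + 2)
  e₂ = solve-∀
  e₃ : ∀ x y u w z → (x + y) + u + w + z ≡ (x + u) + (y + w) + z
  e₃ = solve-∀
  e₄ : ∀ a b c → ((a + 1) * (a + 1) + ((b + 1) + (a + c))) + ((b + 1) * (b + 1) + ((a + 1) + (b + c))) + (a + b + 2)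
                 ≡ a * a + b * b + (c + c) + (4 * (a + b + 1) + (a + 1) + (b + 1))
  e₄ = solve-∀

-- Halving, with  a² = 2·C(a , 2) + a  and  2t = 2c .
halve : ∀ {P aᵢ aⱼ c t} → 2 * P + (aᵢ + aⱼ) ≡ aᵢ * aᵢ + aⱼ * aⱼ + (c + c) → 2 * t ≡ c + c →
  P ≡ t + aᵢ C 2 + aⱼ C 2
halve {P} {a} {b} {c} {t} twice tc = *-cancelˡ-≡ P (t + a C 2 + b C 2) 2 (+-cancelʳ-≡ (a + b) _ _ (begin
  2 * P + (a + b)                                        ≡⟨ twice ⟩
  a * a + b * b + (c + c)                                ≡⟨ cong₃ (two-choose-two a) (two-choose-two b) tc ⟨
  (2 * (a C 2) + a) + (2 * (b C 2) + b) + 2 * t          ≡⟨ regroup t (a C 2) (b C 2) a b ⟩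
  2 * (t + a C 2 + b C 2) + (a + b)                      ∎))
  where
  open ≡-Reasoning
  cong₃ : ∀ {x x′ y y′ z z′} → x ≡ x′ → y ≡ y′ → z ≡ z′ → x + y + z ≡ x′ + y′ + z′
  cong₃ refl refl refl = refl
  regroup : ∀ t x y a b → (2 * x + a) + (2 * y + b) + 2 * t ≡ 2 * (t + x + y) + (a + b)
  regroup = solve-∀

module LineGraphAt (G : Graph) (v : Fin (length (edges G))) where
  open EdgeSums G

  private
    ℓ = length (edges G)
    E : Fin ℓ → Fin (n G) × Fin (n G)
    E = lookup (edges G)

  i j : Fin (n G)
  i = proj₁ (E v)
  j = proj₂ (E v)

  ij : T (adj G i j)
  ij = edges-adjacent v

  open AtEdge i j ij public

  -- adjacency in L(G) is  Loopless.α  for the relation "shares an endpoint"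
  open Loopless (λ k l → share (E k) (E l))
                (λ k → share-same-start (proj₁ (E k)) (proj₂ (E k)) (proj₂ (E k)))
                (λ k l → share-sym (E k) (E l)) v

  primDeg-twice : 2 * primDeg (lineGraph G) v ≡ ∑[ k < ℓ ] ∑[ l < ℓ ] χ (α v k ∧ α k l ∧ α v l)
  primDeg-twice =
    trans (cong (2 *_) (count-cong (λ t → cong (isTriangle (lineGraph G) t ∧_) (≡-sym (∧-identityʳ (contains t v))))
                                   (triples ℓ)))
    (trans (Through.triangles-through v)
           (sum-cong-≗ λ k → sum-cong-≗ λ l → cong χ (∧-identityʳ (α v k ∧ α k l ∧ α v l))))
    where
    module Through = TrianglesThrough (lineGraph G) (λ _ → true) (λ _ _ _ → refl) (λ _ _ _ → refl)

  N-as-edges : ∑[ k < ℓ ] χ (share e (E k)) ≡ N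
  N-as-edges = ∑-edges (λ f → χ (share e f))

  Q-as-edges : ∑[ k < ℓ ] ∑[ l < ℓ ] χ (share e (E k) ∧ share (E k) (E l) ∧ share e (E l)) ≡ Q
  Q-as-edges = begin
    ∑[ k < ℓ ] ∑[ l < ℓ ] χ (share e (E k) ∧ share (E k) (E l) ∧ share e (E l))
      ≡⟨ sum-cong-≗ (λ k → sum-cong-≗ λ l → reorder (share e (E k)) (share (E k) (E l)) (share e (E l))) ⟩
    ∑[ k < ℓ ] ∑[ l < ℓ ] (χ (share e (E k)) * (χ (share e (E l)) * χ (share (E k) (E l))))
      ≡⟨ sum-cong-≗ (λ k → trans (∑-*ˡ (χ (share e (E k))) (λ l → χ (share e (E l)) * χ (share (E k) (E l))))
                                 (cong (χ (share e (E k)) *_) (∑-edges (λ g → χ (share e g) * χ (share (E k) g))))) ⟩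
    ∑[ k < ℓ ] (χ (share e (E k)) * R (E k))
      ≡⟨ ∑-edges (λ f → χ (share e f) * R f) ⟩
    Q ∎
    where
    open ≡-Reasoning
    reorder : ∀ a b c → χ (a ∧ b ∧ c) ≡ χ a * (χ c * χ b)
    reorder a b c = trans (χ-∧ a (b ∧ c)) (cong (χ a *_) (trans (χ-∧ b c) (*-comm (χ b) (χ c))))

  line-graph-count : 2 * primDeg (lineGraph G) v + 3 * N ≡ Q + 2
  line-graph-count =
    trans (cong₂ (λ x y → x + 3 * y) primDeg-twice (≡-sym N-as-edges))
          (trans loopless-pairs (cong (_+ 2) Q-as-edges))

  twice-primDeg : 2 * primDeg (lineGraph G) v + (d⁻ i j + d⁻ j i)
                    ≡ d⁻ i j * d⁻ i j + d⁻ j i * d⁻ j i + (common i j + common i j)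
  twice-primDeg =
    twice-count {P = primDeg (lineGraph G) v} {aᵢ = d⁻ i j} {aⱼ = d⁻ j i} {c = common i j} {c′ = common j i}
      line-graph-count N-count Q-count S-count-i S-count-j (d≡d⁻+1 ij) (d≡d⁻+1 ji) (common-sym j i)

theorem4p3 : (G : Graph) (v : Fin (length (edges G))) →
    primDeg (lineGraph G) v
      ≡ triEdge G (proj₁ (lookup (edges G) v)) (proj₂ (lookup (edges G) v))
        + ((deg G (proj₁ (lookup (edges G) v)) ∸ 1) C 2)
        + ((deg G (proj₂ (lookup (edges G) v)) ∸ 1) C 2)
theorem4p3 G v = begin
  primDeg (lineGraph G) v
    ≡⟨ halve {aᵢ = d⁻ i j} {aⱼ = d⁻ j i} {c = common i j} {t = triEdge G i j} twice-primDeg triangles-at-edge ⟩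
  triEdge G i j + d⁻ i j C 2 + d⁻ j i C 2
    ≡⟨ cong₂ (λ x y → triEdge G i j + x C 2 + y C 2) (deg-pred ij) (deg-pred ji) ⟨
  triEdge G i j + (deg G i ∸ 1) C 2 + (deg G j ∸ 1) C 2 ∎
  where
  open ≡-Reasoning
  open LineGraphAt G v
  open EdgeSums G
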